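{- Let $K = \mathbb{Q}(\sqrt{D})$ be a real quadratic field, where $D \geq 2$ is a squarefree integer. Then $$\mathcal{N}_K = \{x \in \mathbb{Z}_{\geq 1} : x^2 - Dy^2 = \pm 4 \text{ for some } y \in \mathbb{Z}\}.$$ In particular, for every positive integer $n \neq 2$, $n \in \mathcal{N}_K$ if and only if $K = \mathbb{Q}(\sqrt{n^2 \pm 4})$ (for one of the two choices of sign).
   Context: For a number field $K$, $\mathcal{N}_K$ is the set of positive integers $n$ such that $n = \varepsilon + \delta$ for some units $\varepsilon, \delta \in \mathcal{O}_K^\times$. -}

module Defs where

open import Data.Nat as ℕ using (ℕ; suc)
open import Data.Nat.Divisibility as ℕD using ()
open import Data.Integer as ℤ using (ℤ; +_)
open import Data.Rational as ℚ using (ℚ; _/_)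
open import Data.List using (List; foldl)
open import Data.Product using (_×_; _,_; ∃-syntax; proj₂)
open import Relation.Binary.PropositionalEquality using (_≡_; _≢_)

SquareFree : ℕ → Set
SquareFree D = ∀ (p : ℕ) → (p ℕ.* p) ℕD.∣ D → p ≡ 1

-- Elements of K = ℚ(√D): the pair (a , b) stands for a + b √D.
QF : Set
QF = ℚ × ℚ

module QuadField (D : ℕ) where

  Dℚ : ℚ
  Dℚ = (+ D) / 1

  _⊕_ : QF → QF → QF
  (a , b) ⊕ (c , d) = (a ℚ.+ c , b ℚ.+ d)

  _⊗_ : QF → QF → QF
  (a , b) ⊗ (c , d) = (a ℚ.* c ℚ.+ Dℚ ℚ.* (b ℚ.* d) , a ℚ.* d ℚ.+ b ℚ.* c)

  ι : ℤ → QF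
  ι z = (z / 1 , ℚ.0ℚ)

  one : QF
  one = ι (+ 1)

  -- Value at x of the monic polynomial X^n + c₁ X^(n-1) + … + cₙ,
  -- where the list is [c₁ , … , cₙ] (Horner scheme).
  evalMonic : List ℤ → QF → QF
  evalMonic cs x = foldl (λ acc c → (acc ⊗ x) ⊕ ι c) one cs

  IsIntegral : QF → Set
  IsIntegral x = ∃[ cs ] evalMonic cs x ≡ ι (+ 0)

  IsUnit : QF → Set
  IsUnit ε = IsIntegral ε × ∃[ η ] (IsIntegral η × ε ⊗ η ≡ one)

  InN : ℕ → Set
  InN n = (1 ℕ.≤ n) × ∃[ ε ] ∃[ δ ] (IsUnit ε × IsUnit δ × ε ⊕ δ ≡ ι (+ n))

  -- K = ℚ(√m) for an integer m: K contains a square root x of m which is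
  -- irrational (not in ℚ), so ℚ(√m) = ℚ(x) ⊆ K has degree 2, hence equals K.
  IsQSqrt : ℤ → Set
  IsQSqrt m = ∃[ x ] (x ⊗ x ≡ ι m × proj₂ x ≢ ℚ.0ℚ)

-- A unit ε = a + b √D is integral together with its inverse, so its norm a² − D b² is ±1 once we know
-- that an integral x has integral norm and trace 2a.  That follows from bounded denominators: all powers
-- of x lie in (1/L) ℤ² for one L, hence L² N(x)ᵏ ∈ ℤ for every k, which forces N x ∈ ℤ; and
-- 2a = N(x + 1) − N x − 1.  As D is squarefree, ε = (A + Y √D)/2 with A² − D Y² = ±4.
-- If ε + δ = n, then δ = (C − Y √D)/2 with A + C = 2n, and (A − n) n = (N ε − N δ) ∈ {0, ±2}:
-- either A = n, giving n² − D Y² = ±4, or n ∈ {1, 2}, where a solution is read off directly.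
-- Conversely (n ± y √D)/2 are units with sum n.  For n ≠ 2 a solution has y ≠ 0, and D y² = n² ∓ 4
-- with y ≠ 0 says precisely that y √D is an irrational square root of n² ∓ 4 in K.

module Submission where

open import Defs
open import Data.Nat as ℕ using (ℕ; suc; zero; _≤_; _<_)
import Data.Nat.Properties as ℕP
open import Data.Nat.Divisibility as ℕD using (_∣_; divides)
open import Data.Nat.Coprimality as Cop using (Coprime)
open import Data.Integer as ℤ using (ℤ; +_; -[1+_]; -_; 1ℤ; -1ℤ)
import Data.Integer.Properties as ℤP
open import Data.Rational as ℚ using (ℚ; _/_; mkℚ; ½; 0ℚ; 1ℚ)
import Data.Rational.Properties as ℚP
import Data.Rational.Unnormalised as ℚᵘ
import Data.Rational.Unnormalised.Properties as ℚᵘP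
open import Algebra.Definitions.RawSemiring ℚ.+-*-rawSemiring using () renaming (_^_ to _^ℚ_)
open import Relation.Binary.PropositionalEquality
open import Data.Product using (Σ; _×_; _,_; proj₁; proj₂; ∃-syntax)
open import Data.Sum using (_⊎_; inj₁; inj₂)
open import Function using (_∘_)
open import Function.Bundles using (_⇔_; mk⇔)
open import Data.List using (List; []; _∷_; foldl; length)
open import Relation.Nullary using (yes; no; contradiction)
import Data.Rational.Solver as ℚSolver
import Data.Integer.Solver as ℤSolver

fromℤ : ℤ → ℚ
fromℤ z = z / 1

-- z / 1 as a constructor application, on which the ring operations of ℚ compute
fromℤ′ : ℤ → ℚ
fromℤ′ z = mkℚ z 0 (Cop.sym (Cop.1-coprimeTo ℤ.∣ z ∣))

fromℤ≡fromℤ′ : ∀ z → fromℤ z ≡ fromℤ′ z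
fromℤ≡fromℤ′ z = ℚP.↥p/↧p≡p (fromℤ′ z)

fromℤ-injective : ∀ {a b} → fromℤ a ≡ fromℤ b → a ≡ b
fromℤ-injective {a} {b} eq rewrite fromℤ≡fromℤ′ a | fromℤ≡fromℤ′ b = cong ℚ.↥_ eq

fromℤ-* : ∀ a b → fromℤ (a ℤ.* b) ≡ fromℤ a ℚ.* fromℤ b
fromℤ-* a b rewrite fromℤ≡fromℤ′ a | fromℤ≡fromℤ′ b = refl

fromℤ-+ : ∀ a b → fromℤ (a ℤ.+ b) ≡ fromℤ a ℚ.+ fromℤ b
fromℤ-+ a b rewrite fromℤ≡fromℤ′ a | fromℤ≡fromℤ′ b =
  cong fromℤ (cong₂ ℤ._+_ (sym (ℤP.*-identityʳ a)) (sym (ℤP.*-identityʳ b)))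

fromℤ-neg : ∀ a → fromℤ (- a) ≡ ℚ.- fromℤ a
fromℤ-neg a rewrite fromℤ≡fromℤ′ (- a) | fromℤ≡fromℤ′ a = fromℤ′-neg a
  where
  fromℤ′-neg : ∀ a → fromℤ′ (- a) ≡ ℚ.- fromℤ′ a
  fromℤ′-neg (+ zero)  = refl
  fromℤ′-neg (+ suc n) = refl
  fromℤ′-neg -[1+ n ]  = refl

fromℤ-- : ∀ a b → fromℤ (a ℤ.- b) ≡ fromℤ a ℚ.- fromℤ b
fromℤ-- a b = trans (fromℤ-+ a (- b)) (cong (fromℤ a ℚ.+_) (fromℤ-neg b))

fromℤ-pos-* : ∀ m n → fromℤ (+ (m ℕ.* n)) ≡ fromℤ (+ m) ℚ.* fromℤ (+ n)
fromℤ-pos-* m n = trans (cong fromℤ (ℤP.pos-* m n)) (fromℤ-* (+ m) (+ n))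

infix 4 _∈ℤ
_∈ℤ : ℚ → Set
r ∈ℤ = ∃[ z ] r ≡ fromℤ z

fromℤ∈ℤ : ∀ z → fromℤ z ∈ℤ
fromℤ∈ℤ z = z , refl

∈ℤ-+ : ∀ {p q} → p ∈ℤ → q ∈ℤ → p ℚ.+ q ∈ℤ
∈ℤ-+ (a , refl) (b , refl) = a ℤ.+ b , sym (fromℤ-+ a b)

∈ℤ-* : ∀ {p q} → p ∈ℤ → q ∈ℤ → p ℚ.* q ∈ℤ
∈ℤ-* (a , refl) (b , refl) = a ℤ.* b , sym (fromℤ-* a b)

∈ℤ-neg : ∀ {p} → p ∈ℤ → ℚ.- p ∈ℤ
∈ℤ-neg (a , refl) = - a , sym (fromℤ-neg a)

∈ℤ-- : ∀ {p q} → p ∈ℤ → q ∈ℤ → p ℚ.- q ∈ℤ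
∈ℤ-- p∈ℤ q∈ℤ = ∈ℤ-+ p∈ℤ (∈ℤ-neg q∈ℤ)

↧*p≡↥ : ∀ p → fromℤ (ℚ.↧ p) ℚ.* p ≡ fromℤ (ℚ.↥ p)
↧*p≡↥ p@(mkℚ n d _) rewrite fromℤ≡fromℤ′ (+ suc d) | fromℤ≡fromℤ′ n = ℚP.toℚᵘ-injective
  (ℚᵘP.≃-trans (ℚP.toℚᵘ-homo-* (fromℤ′ (+ suc d)) p) (ℚᵘ.*≡* cross))
  where
  cross : (+ suc d ℤ.* n) ℤ.* + 1 ≡ n ℤ.* + (1 ℕ.* suc d)
  cross rewrite ℕP.*-identityˡ (suc d) = trans (ℤP.*-identityʳ _) (ℤP.*-comm (+ suc d) n)

↧ₙ*p∈ℤ : ∀ p → fromℤ (+ ℚ.↧ₙ p) ℚ.* p ∈ℤ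
↧ₙ*p∈ℤ p = ℚ.↥ p , ↧*p≡↥ p

∈ℤ-pos-*ˡ : ∀ M {L p} → fromℤ (+ L) ℚ.* p ∈ℤ → fromℤ (+ (M ℕ.* L)) ℚ.* p ∈ℤ
∈ℤ-pos-*ˡ M {L} {p} lp = subst _∈ℤ
  (sym (trans (cong (ℚ._* p) (fromℤ-pos-* M L)) (ℚP.*-assoc (fromℤ (+ M)) (fromℤ (+ L)) p)))
  (∈ℤ-* (fromℤ∈ℤ (+ M)) lp)

↧ₙ≡1⇒∈ℤ : ∀ p → ℚ.↧ₙ p ≡ 1 → p ∈ℤ
↧ₙ≡1⇒∈ℤ p@(mkℚ n zero _) refl = n , trans (sym (ℚP.*-identityˡ p)) (↧*p≡↥ p)

↧^*p^≡↥^ : ∀ p k → fromℤ (ℚ.↧ p ℤ.^ k) ℚ.* p ^ℚ k ≡ fromℤ (ℚ.↥ p ℤ.^ k)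
↧^*p^≡↥^ p zero    = refl
↧^*p^≡↥^ p (suc k) = begin
  fromℤ (↧p ℤ.* ↧p ℤ.^ k) ℚ.* (p ℚ.* p ^ℚ k)
    ≡⟨ cong (ℚ._* (p ℚ.* p ^ℚ k)) (fromℤ-* ↧p (↧p ℤ.^ k)) ⟩
  fromℤ ↧p ℚ.* fromℤ (↧p ℤ.^ k) ℚ.* (p ℚ.* p ^ℚ k)
    ≡⟨ solve 4 (λ a b c d → a :* b :* (c :* d) := (a :* c) :* (b :* d)) refl
         (fromℤ ↧p) (fromℤ (↧p ℤ.^ k)) p (p ^ℚ k) ⟩
  (fromℤ ↧p ℚ.* p) ℚ.* (fromℤ (↧p ℤ.^ k) ℚ.* p ^ℚ k)
    ≡⟨ cong₂ ℚ._*_ (↧*p≡↥ p) (↧^*p^≡↥^ p k) ⟩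
  fromℤ (ℚ.↥ p) ℚ.* fromℤ (ℚ.↥ p ℤ.^ k)
    ≡⟨ fromℤ-* (ℚ.↥ p) (ℚ.↥ p ℤ.^ k) ⟨
  fromℤ (ℚ.↥ p ℤ.^ suc k) ∎
  where
  open ≡-Reasoning
  open ℚSolver.+-*-Solver
  ↧p : ℤ
  ↧p = ℚ.↧ p

coprime-*ʳ : ∀ {m n o} → Coprime m n → Coprime m o → Coprime m (n ℕ.* o)
coprime-*ʳ {o = o} m⊥n m⊥o (d∣m , d∣no) =
  m⊥o (d∣m , Cop.coprime-factors m⊥n (ℕD.∣m⇒∣m*n o d∣m , d∣no))

coprime-^ʳ : ∀ {m n} → Coprime m n → ∀ k → Coprime m (n ℕ.^ k)
coprime-^ʳ m⊥n zero    = Cop.sym (Cop.1-coprimeTo _)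
coprime-^ʳ m⊥n (suc k) = coprime-*ʳ m⊥n (coprime-^ʳ m⊥n k)

coprime-^ : ∀ {m n} → Coprime m n → ∀ j k → Coprime (m ℕ.^ j) (n ℕ.^ k)
coprime-^ m⊥n j k = Cop.sym (coprime-^ʳ (Cop.sym (coprime-^ʳ m⊥n k)) j)

∣i^k∣≡∣i∣^k : ∀ i k → ℤ.∣ i ℤ.^ k ∣ ≡ ℤ.∣ i ∣ ℕ.^ k
∣i^k∣≡∣i∣^k i zero    = refl
∣i^k∣≡∣i∣^k i (suc k) = trans (ℤP.abs-* i (i ℤ.^ k)) (cong (ℤ.∣ i ∣ ℕ.*_) (∣i^k∣≡∣i∣^k i k))

n<m^n : ∀ {m} → 1 < m → ∀ n → n < m ℕ.^ n
n<m^n 1<m zero    = ℕ.z<s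
n<m^n {m} 1<m (suc n) = ℕP.≤-<-trans (n<m^n 1<m n) (ℕP.^-monoʳ-< m 1<m (ℕP.n<1+n n))

-- M pᵏ = z in lowest terms p = a / b forces bᵏ ∣ M, since bᵏ is coprime to aᵏ.
↧ₙ^∣ : ∀ M k p z → fromℤ (+ M) ℚ.* p ^ℚ k ≡ fromℤ z → ℚ.↧ₙ p ℕ.^ k ∣ M
↧ₙ^∣ M k p@(mkℚ a _ a⊥b) z eq =
  Cop.coprime-divisor (coprime-^ (Cop.sym (Cop.recompute a⊥b)) k k) (divides ℤ.∣ z ∣ natEq)
  where
  open ≡-Reasoning
  open ℚSolver.+-*-Solver
  intEq : + M ℤ.* a ℤ.^ k ≡ ℚ.↧ p ℤ.^ k ℤ.* z
  intEq = fromℤ-injective (begin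
    fromℤ (+ M ℤ.* a ℤ.^ k)                           ≡⟨ fromℤ-* (+ M) (a ℤ.^ k) ⟩
    fromℤ (+ M) ℚ.* fromℤ (a ℤ.^ k)                   ≡⟨ cong (fromℤ (+ M) ℚ.*_) (↧^*p^≡↥^ p k) ⟨
    fromℤ (+ M) ℚ.* (fromℤ (ℚ.↧ p ℤ.^ k) ℚ.* p ^ℚ k)
      ≡⟨ solve 3 (λ m d q → m :* (d :* q) := d :* (m :* q)) refl (fromℤ (+ M)) (fromℤ (ℚ.↧ p ℤ.^ k)) (p ^ℚ k) ⟩
    fromℤ (ℚ.↧ p ℤ.^ k) ℚ.* (fromℤ (+ M) ℚ.* p ^ℚ k)  ≡⟨ cong (fromℤ (ℚ.↧ p ℤ.^ k) ℚ.*_) eq ⟩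
    fromℤ (ℚ.↧ p ℤ.^ k) ℚ.* fromℤ z                   ≡⟨ fromℤ-* (ℚ.↧ p ℤ.^ k) z ⟨
    fromℤ (ℚ.↧ p ℤ.^ k ℤ.* z)                         ∎)
  natEq : ℤ.∣ a ∣ ℕ.^ k ℕ.* M ≡ ℤ.∣ z ∣ ℕ.* ℚ.↧ₙ p ℕ.^ k
  natEq = begin
    ℤ.∣ a ∣ ℕ.^ k ℕ.* M               ≡⟨ ℕP.*-comm (ℤ.∣ a ∣ ℕ.^ k) M ⟩
    M ℕ.* ℤ.∣ a ∣ ℕ.^ k               ≡⟨ cong (M ℕ.*_) (∣i^k∣≡∣i∣^k a k) ⟨
    M ℕ.* ℤ.∣ a ℤ.^ k ∣               ≡⟨ ℤP.abs-* (+ M) (a ℤ.^ k) ⟨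
    ℤ.∣ + M ℤ.* a ℤ.^ k ∣             ≡⟨ cong ℤ.∣_∣ intEq ⟩
    ℤ.∣ ℚ.↧ p ℤ.^ k ℤ.* z ∣           ≡⟨ ℤP.abs-* (ℚ.↧ p ℤ.^ k) z ⟩
    ℤ.∣ ℚ.↧ p ℤ.^ k ∣ ℕ.* ℤ.∣ z ∣     ≡⟨ cong (ℕ._* ℤ.∣ z ∣) (∣i^k∣≡∣i∣^k (ℚ.↧ p) k) ⟩
    ℚ.↧ₙ p ℕ.^ k ℕ.* ℤ.∣ z ∣          ≡⟨ ℕP.*-comm (ℚ.↧ₙ p ℕ.^ k) ℤ.∣ z ∣ ⟩
    ℤ.∣ z ∣ ℕ.* ℚ.↧ₙ p ℕ.^ k          ∎

bounded-denominators⇒∈ℤ : ∀ M .{{_ : ℕ.NonZero M}} p → (∀ k → fromℤ (+ M) ℚ.* p ^ℚ k ∈ℤ) → p ∈ℤ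
bounded-denominators⇒∈ℤ M p@(mkℚ _ zero    _) _ = ↧ₙ≡1⇒∈ℤ p refl
bounded-denominators⇒∈ℤ M p@(mkℚ _ (suc _) _) h = contradiction
  (ℕD.∣⇒≤ (↧ₙ^∣ M M p (proj₁ (h M)) (proj₂ (h M))))
  (ℕP.<⇒≱ (n<m^n (ℕ.s≤s (ℕ.s≤s ℕ.z≤n)) M))

squarefree⇒∈ℤ : ∀ {D} → SquareFree D → ∀ p z → fromℤ (+ D) ℚ.* (p ℚ.* p) ≡ fromℤ z → p ∈ℤ
squarefree⇒∈ℤ {D} sf p z eq = ↧ₙ≡1⇒∈ℤ p (sf (ℚ.↧ₙ p)
  (subst (_∣ D) (cong (ℚ.↧ₙ p ℕ.*_) (ℕP.*-identityʳ (ℚ.↧ₙ p)))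
    (↧ₙ^∣ D 2 p z (trans (cong (λ q → fromℤ (+ D) ℚ.* (p ℚ.* q)) (ℚP.*-identityʳ p)) eq))))

scaled-conjugate-norm : ∀ d s u v →
  (s ℤ.* u) ℤ.* (s ℤ.* u) ℤ.- d ℤ.* (- (s ℤ.* v) ℤ.* - (s ℤ.* v))
    ≡ (s ℤ.* s) ℤ.* (u ℤ.* u ℤ.- d ℤ.* (v ℤ.* v))
scaled-conjugate-norm = solve 4 (λ d s u v → (s :* u) :* (s :* u) :- d :* ((:- (s :* v)) :* (:- (s :* v)))
                                           := (s :* s) :* (u :* u :- d :* (v :* v))) refl
  where open ℤSolver.+-*-Solver

-i*-i≡i*i : ∀ i → - i ℤ.* - i ≡ i ℤ.* i
-i*-i≡i*i = solve 1 (λ i → (:- i) :* (:- i) := i :* i) refl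
  where open ℤSolver.+-*-Solver

i*j≡1⇒i≡±1 : ∀ i j → i ℤ.* j ≡ 1ℤ → i ≡ 1ℤ ⊎ i ≡ -1ℤ
i*j≡1⇒i≡±1 i j ij≡1 =
  ∣i∣≡1⇒i≡±1 i (ℕP.m*n≡1⇒m≡1 ℤ.∣ i ∣ ℤ.∣ j ∣ (trans (sym (ℤP.abs-* i j)) (cong ℤ.∣_∣ ij≡1)))
  where
  ∣i∣≡1⇒i≡±1 : ∀ i → ℤ.∣ i ∣ ≡ 1 → i ≡ 1ℤ ⊎ i ≡ -1ℤ
  ∣i∣≡1⇒i≡±1 (+ 1)    _ = inj₁ refl
  ∣i∣≡1⇒i≡±1 -[1+ 0 ] _ = inj₂ refl

Pell±4 : ℕ → ℕ → ℤ → Set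
Pell±4 D n y = (+ n) ℤ.* (+ n) ℤ.- (+ D) ℤ.* (y ℤ.* y) ≡ + 4
              ⊎ (+ n) ℤ.* (+ n) ℤ.- (+ D) ℤ.* (y ℤ.* y) ≡ - (+ 4)

i-j≡k⇒j≡i-k : ∀ i j k → i ℤ.- j ≡ k → j ≡ i ℤ.- k
i-j≡k⇒j≡i-k i j k i-j≡k = trans (solve 2 (λ i j → j := i :- (i :- j)) refl i j) (cong (λ t → i ℤ.- t) i-j≡k)
  where open ℤSolver.+-*-Solver

j≡i-k⇒i-j≡k : ∀ i j k → j ≡ i ℤ.- k → i ℤ.- j ≡ k
j≡i-k⇒i-j≡k i j k j≡i-k = trans (cong (λ t → i ℤ.- t) j≡i-k) (solve 2 (λ i k → i :- (i :- k) := k) refl i k)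
  where open ℤSolver.+-*-Solver

i-j≡k⇒i≡k+j : ∀ i j k → i ℤ.- j ≡ k → i ≡ k ℤ.+ j
i-j≡k⇒i≡k+j i j k i-j≡k = trans (solve 2 (λ i j → i := (i :- j) :+ j) refl i j) (cong (ℤ._+ j) i-j≡k)
  where open ℤSolver.+-*-Solver

-- A² − C² = 4(e₁ − e₂), while A² − C² = (A − C)(A + C) = 2(A − n) · 2n.
[A-n]n≡e₁-e₂ : ∀ D n A C Y e₁ e₂ →
  A ℤ.* A ℤ.- + D ℤ.* (Y ℤ.* Y) ≡ + 4 ℤ.* e₁ → C ℤ.* C ℤ.- + D ℤ.* (Y ℤ.* Y) ≡ + 4 ℤ.* e₂ →
  A ℤ.+ C ≡ + 2 ℤ.* + n → (A ℤ.- + n) ℤ.* + n ≡ e₁ ℤ.- e₂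
[A-n]n≡e₁-e₂ D n A C Y e₁ e₂ pell₁ pell₂ A+C≡2n = ℤP.*-cancelʳ-≡ _ _ (+ 4) (begin
  (A ℤ.- + n) ℤ.* + n ℤ.* + 4
    ≡⟨ solve 3 (λ A n W → (A :- n) :* n :* con (+ 4)
                           := (A :* A :- W) :- ((con (+ 2) :* n :- A) :* (con (+ 2) :* n :- A) :- W)) refl A (+ n) W ⟩
  (A ℤ.* A ℤ.- W) ℤ.- ((+ 2 ℤ.* + n ℤ.- A) ℤ.* (+ 2 ℤ.* + n ℤ.- A) ℤ.- W)
    ≡⟨ cong (λ c → (A ℤ.* A ℤ.- W) ℤ.- (c ℤ.* c ℤ.- W)) C≡2n-A ⟨
  (A ℤ.* A ℤ.- W) ℤ.- (C ℤ.* C ℤ.- W)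
    ≡⟨ cong₂ ℤ._-_ pell₁ pell₂ ⟩
  + 4 ℤ.* e₁ ℤ.- + 4 ℤ.* e₂
    ≡⟨ solve 2 (λ e₁ e₂ → con (+ 4) :* e₁ :- con (+ 4) :* e₂ := (e₁ :- e₂) :* con (+ 4)) refl e₁ e₂ ⟩
  (e₁ ℤ.- e₂) ℤ.* + 4 ∎)
  where
  open ≡-Reasoning
  open ℤSolver.+-*-Solver
  W : ℤ
  W = + D ℤ.* (Y ℤ.* Y)
  C≡2n-A : C ≡ + 2 ℤ.* + n ℤ.- A
  C≡2n-A = trans (solve 2 (λ A C → C := (A :+ C) :- A) refl A C) (cong (ℤ._- A) A+C≡2n)

[A-n]n≡0⇒A≡n : ∀ {n} A → 1 ≤ n → (A ℤ.- + n) ℤ.* + n ≡ + 0 → A ≡ + n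
[A-n]n≡0⇒A≡n {n} A n≥1 [A-n]n≡0 with ℤP.i*j≡0⇒i≡0∨j≡0 (A ℤ.- + n) [A-n]n≡0
... | inj₁ A-n≡0 = trans (i-j≡k⇒i≡k+j A (+ n) (+ 0) A-n≡0) (ℤP.+-identityˡ (+ n))
... | inj₂ n≡0   = contradiction (ℤP.+-injective n≡0) (ℕP.n>0⇒n≢0 n≥1)

∣k*n∣≡2⇒n≡1⊎n≡2 : ∀ {n} k → 1 ≤ n → ℤ.∣ k ℤ.* + n ∣ ≡ 2 → n ≡ 1 ⊎ n ≡ 2
∣k*n∣≡2⇒n≡1⊎n≡2 {n} k n≥1 ∣kn∣≡2 =
  small n n≥1 (ℕD.∣⇒≤ (divides ℤ.∣ k ∣ (sym (trans (sym (ℤP.abs-* k (+ n))) ∣kn∣≡2))))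
  where
  small : ∀ n → 1 ≤ n → n ≤ 2 → n ≡ 1 ⊎ n ≡ 2
  small 1 _ _ = inj₁ refl
  small 2 _ _ = inj₂ refl
  small (suc (suc (suc _))) _ (ℕ.s≤s (ℕ.s≤s ()))

Pell±4-at-2 : ∀ D → Pell±4 D 2 (+ 0)
Pell±4-at-2 D rewrite ℤP.*-zeroʳ (+ D) = inj₁ refl

-- D Y² = A² − 4e = (1 + 2e)² − 4e = 5.
Pell±4-at-1 : ∀ D A Y e → A ℤ.- + 1 ≡ + 2 ℤ.* e → e ℤ.* e ≡ 1ℤ →
  A ℤ.* A ℤ.- + D ℤ.* (Y ℤ.* Y) ≡ + 4 ℤ.* e → Pell±4 D 1 Y
Pell±4-at-1 D A Y e A-1≡2e e²≡1 pell = inj₂ (begin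
  + 1 ℤ.* + 1 ℤ.- W
    ≡⟨ cong (λ t → + 1 ℤ.* + 1 ℤ.- t) (i-j≡k⇒j≡i-k (A ℤ.* A) W (+ 4 ℤ.* e) pell) ⟩
  + 1 ℤ.* + 1 ℤ.- (A ℤ.* A ℤ.- + 4 ℤ.* e)
    ≡⟨ cong (λ a → + 1 ℤ.* + 1 ℤ.- (a ℤ.* a ℤ.- + 4 ℤ.* e)) (i-j≡k⇒i≡k+j A (+ 1) (+ 2 ℤ.* e) A-1≡2e) ⟩
  + 1 ℤ.* + 1 ℤ.- ((+ 2 ℤ.* e ℤ.+ + 1) ℤ.* (+ 2 ℤ.* e ℤ.+ + 1) ℤ.- + 4 ℤ.* e)
    ≡⟨ solve 1 (λ e → con (+ 1) :* con (+ 1)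
                       :- ((con (+ 2) :* e :+ con (+ 1)) :* (con (+ 2) :* e :+ con (+ 1)) :- con (+ 4) :* e)
                     := con (- + 4) :* (e :* e)) refl e ⟩
  - + 4 ℤ.* (e ℤ.* e)
    ≡⟨ cong (- + 4 ℤ.*_) e²≡1 ⟩
  - + 4 ∎)
  where
  open ≡-Reasoning
  open ℤSolver.+-*-Solver
  W : ℤ
  W = + D ℤ.* (Y ℤ.* Y)

traces⇒Pell±4 : ∀ D n A Y {e₁ e₂} → 1 ≤ n → (e₁ ≡ 1ℤ ⊎ e₁ ≡ -1ℤ) → (e₂ ≡ 1ℤ ⊎ e₂ ≡ -1ℤ) →
  (A ℤ.- + n) ℤ.* + n ≡ e₁ ℤ.- e₂ → A ℤ.* A ℤ.- + D ℤ.* (Y ℤ.* Y) ≡ + 4 ℤ.* e₁ → ∃[ y ] Pell±4 D n y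
traces⇒Pell±4 D n A Y n≥1 (inj₁ refl) (inj₁ refl) [A-n]n≡0 pell =
  Y , inj₁ (subst (λ a → a ℤ.* a ℤ.- + D ℤ.* (Y ℤ.* Y) ≡ + 4) ([A-n]n≡0⇒A≡n A n≥1 [A-n]n≡0) pell)
traces⇒Pell±4 D n A Y n≥1 (inj₂ refl) (inj₂ refl) [A-n]n≡0 pell =
  Y , inj₂ (subst (λ a → a ℤ.* a ℤ.- + D ℤ.* (Y ℤ.* Y) ≡ - + 4) ([A-n]n≡0⇒A≡n A n≥1 [A-n]n≡0) pell)
traces⇒Pell±4 D n A Y n≥1 (inj₁ refl) (inj₂ refl) [A-n]n≡2 pell
  with ∣k*n∣≡2⇒n≡1⊎n≡2 (A ℤ.- + n) n≥1 (cong ℤ.∣_∣ [A-n]n≡2)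
... | inj₁ refl = Y , Pell±4-at-1 D A Y 1ℤ (trans (sym (ℤP.*-identityʳ _)) [A-n]n≡2) refl pell
... | inj₂ refl = + 0 , Pell±4-at-2 D
traces⇒Pell±4 D n A Y n≥1 (inj₂ refl) (inj₁ refl) [A-n]n≡-2 pell
  with ∣k*n∣≡2⇒n≡1⊎n≡2 (A ℤ.- + n) n≥1 (cong ℤ.∣_∣ [A-n]n≡-2)
... | inj₁ refl = Y , Pell±4-at-1 D A Y -1ℤ (trans (sym (ℤP.*-identityʳ _)) [A-n]n≡-2) refl pell
... | inj₂ refl = + 0 , Pell±4-at-2 D

n*n≡4⇒n≡2 : ∀ n → n ℕ.* n ≡ 4 → n ≡ 2
n*n≡4⇒n≡2 2 _ = refl
n*n≡4⇒n≡2 n@(suc (suc (suc _))) n²≡4 =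
  contradiction (subst (9 ≤_) n²≡4 (ℕP.*-mono-≤ 3≤n 3≤n)) λ { (ℕ.s≤s (ℕ.s≤s (ℕ.s≤s (ℕ.s≤s ())))) }
  where
  3≤n : 3 ≤ n
  3≤n = ℕ.s≤s (ℕ.s≤s (ℕ.s≤s ℕ.z≤n))

n²-D·0²≡n² : ∀ D n → + n ℤ.* + n ℤ.- + D ℤ.* (+ 0 ℤ.* + 0) ≡ + (n ℕ.* n)
n²-D·0²≡n² D n = trans (cong (λ t → + n ℤ.* + n ℤ.- t) (ℤP.*-zeroʳ (+ D)))
  (trans (ℤP.+-identityʳ (+ n ℤ.* + n)) (sym (ℤP.pos-* n n)))

Pell±4-at-0⇒n≡2 : ∀ D n → Pell±4 D n (+ 0) → n ≡ 2
Pell±4-at-0⇒n≡2 D n (inj₁ pell) = n*n≡4⇒n≡2 n (ℤP.+-injective (trans (sym (n²-D·0²≡n² D n)) pell))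
Pell±4-at-0⇒n≡2 D n (inj₂ pell) = contradiction (trans (sym (n²-D·0²≡n² D n)) pell) λ ()

D·y²≡n²+4⇒Pell±4 : ∀ D n → (Σ ℤ λ y → + D ℤ.* (y ℤ.* y) ≡ + n ℤ.* + n ℤ.+ + 4) →
                    ∃[ y ] Pell±4 D n y
D·y²≡n²+4⇒Pell±4 D n (y , Dy²≡n²+4) =
  y , inj₂ (j≡i-k⇒i-j≡k (+ n ℤ.* + n) (+ D ℤ.* (y ℤ.* y)) (- + 4) Dy²≡n²+4)

D·y²≡n²-4⇒Pell±4 : ∀ D n → (Σ ℤ λ y → + D ℤ.* (y ℤ.* y) ≡ + n ℤ.* + n ℤ.- + 4) →
                    ∃[ y ] Pell±4 D n y
D·y²≡n²-4⇒Pell±4 D n (y , Dy²≡n²-4) =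
  y , inj₁ (j≡i-k⇒i-j≡k (+ n ℤ.* + n) (+ D ℤ.* (y ℤ.* y)) (+ 4) Dy²≡n²-4)

module QuadFieldProperties (D : ℕ) where
  open QuadField D
  open ℚSolver.+-*-Solver

  ⊗-comm : ∀ u v → u ⊗ v ≡ v ⊗ u
  ⊗-comm (a , b) (c , d) = cong₂ _,_
    (solve 5 (λ a b c d e → a :* c :+ e :* (b :* d) := c :* a :+ e :* (d :* b)) refl a b c d Dℚ)
    (solve 4 (λ a b c d → a :* d :+ b :* c := c :* b :+ d :* a) refl a b c d)

  ⊗-assoc : ∀ u v w → (u ⊗ v) ⊗ w ≡ u ⊗ (v ⊗ w)
  ⊗-assoc (a , b) (c , d) (f , g) = cong₂ _,_
    (solve 7 (λ a b c d f g e → (a :* c :+ e :* (b :* d)) :* f :+ e :* ((a :* d :+ b :* c) :* g)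
                             := a :* (c :* f :+ e :* (d :* g)) :+ e :* (b :* (c :* g :+ d :* f)))
       refl a b c d f g Dℚ)
    (solve 7 (λ a b c d f g e → (a :* c :+ e :* (b :* d)) :* g :+ (a :* d :+ b :* c) :* f
                             := a :* (c :* g :+ d :* f) :+ b :* (c :* f :+ e :* (d :* g)))
       refl a b c d f g Dℚ)

  ⊗-distribʳ-⊕ : ∀ u v w → (u ⊕ v) ⊗ w ≡ (u ⊗ w) ⊕ (v ⊗ w)
  ⊗-distribʳ-⊕ (a , b) (c , d) (f , g) = cong₂ _,_
    (solve 7 (λ a b c d f g e → (a :+ c) :* f :+ e :* ((b :+ d) :* g)
                             := (a :* f :+ e :* (b :* g)) :+ (c :* f :+ e :* (d :* g)))
       refl a b c d f g Dℚ)
    (solve 6 (λ a b c d f g → (a :+ c) :* g :+ (b :+ d) :* f := (a :* g :+ b :* f) :+ (c :* g :+ d :* f))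
       refl a b c d f g)

  ⊗-distribˡ-⊕ : ∀ u v w → u ⊗ (v ⊕ w) ≡ (u ⊗ v) ⊕ (u ⊗ w)
  ⊗-distribˡ-⊕ u v w = begin
    u ⊗ (v ⊕ w)        ≡⟨ ⊗-comm u (v ⊕ w) ⟩
    (v ⊕ w) ⊗ u        ≡⟨ ⊗-distribʳ-⊕ v w u ⟩
    (v ⊗ u) ⊕ (w ⊗ u)  ≡⟨ cong₂ _⊕_ (⊗-comm v u) (⊗-comm w u) ⟩
    (u ⊗ v) ⊕ (u ⊗ w)  ∎
    where open ≡-Reasoning

  ⊗-identityʳ : ∀ u → u ⊗ one ≡ u
  ⊗-identityʳ (a , b) = cong₂ _,_
    (solve 3 (λ a b e → a :* con 1ℚ :+ e :* (b :* con 0ℚ) := a) refl a b Dℚ)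
    (solve 2 (λ a b → a :* con 0ℚ :+ b :* con 1ℚ := b) refl a b)

  ⊗-identityˡ : ∀ u → one ⊗ u ≡ u
  ⊗-identityˡ u = trans (⊗-comm one u) (⊗-identityʳ u)

  ⊗-zeroʳ : ∀ u → u ⊗ ι (+ 0) ≡ ι (+ 0)
  ⊗-zeroʳ (a , b) = cong₂ _,_
    (solve 3 (λ a b e → a :* con 0ℚ :+ e :* (b :* con 0ℚ) := con 0ℚ) refl a b Dℚ)
    (solve 2 (λ a b → a :* con 0ℚ :+ b :* con 0ℚ := con 0ℚ) refl a b)

  ⊕-identityʳ : ∀ u → u ⊕ ι (+ 0) ≡ u
  ⊕-identityʳ (a , b) = cong₂ _,_ (ℚP.+-identityʳ a) (ℚP.+-identityʳ b)

  ⊕-assoc : ∀ u v w → (u ⊕ v) ⊕ w ≡ u ⊕ (v ⊕ w)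
  ⊕-assoc (a , b) (c , d) (f , g) = cong₂ _,_ (ℚP.+-assoc a c f) (ℚP.+-assoc b d g)

  ⊗-left-comm : ∀ u v w → u ⊗ (v ⊗ w) ≡ v ⊗ (u ⊗ w)
  ⊗-left-comm u v w = trans (sym (⊗-assoc u v w)) (trans (cong (_⊗ w) (⊗-comm u v)) (⊗-assoc v u w))

  ι-⊗ : ∀ c a b → ι c ⊗ (a , b) ≡ (fromℤ c ℚ.* a , fromℤ c ℚ.* b)
  ι-⊗ c a b = cong₂ _,_
    (solve 4 (λ a b c e → c :* a :+ e :* (con 0ℚ :* b) := c :* a) refl a b (fromℤ c) Dℚ)
    (solve 3 (λ a b c → c :* b :+ con 0ℚ :* a := c :* b) refl a b (fromℤ c))

  ⊕≡0⇒≡-1⊗ : ∀ u v → u ⊕ v ≡ ι (+ 0) → u ≡ ι (- + 1) ⊗ v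
  ⊕≡0⇒≡-1⊗ (a , b) (c , d) eq =
    trans (cong₂ _,_ (negate a c (cong proj₁ eq)) (negate b d (cong proj₂ eq))) (sym (ι-⊗ (- + 1) c d))
    where
    negate : ∀ a c → a ℚ.+ c ≡ 0ℚ → a ≡ fromℤ (- + 1) ℚ.* c
    negate a c a+c≡0 = trans (solve 2 (λ a c → a := (a :+ c) :+ con (fromℤ (- + 1)) :* c) refl a c)
      (trans (cong (ℚ._+ (fromℤ (- + 1) ℚ.* c)) a+c≡0) (ℚP.+-identityˡ _))

  pow : QF → ℕ → QF
  pow x zero    = one
  pow x (suc k) = pow x k ⊗ x

  pow-+ : ∀ x m j → pow x (m ℕ.+ j) ≡ pow x m ⊗ pow x j
  pow-+ x m zero    = trans (cong (pow x) (ℕP.+-identityʳ m)) (sym (⊗-identityʳ (pow x m)))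
  pow-+ x m (suc j) = trans (cong (pow x) (ℕP.+-suc m j))
    (trans (cong (_⊗ x) (pow-+ x m j)) (⊗-assoc (pow x m) (pow x j) x))

  N : QF → ℚ
  N (a , b) = a ℚ.* a ℚ.- Dℚ ℚ.* (b ℚ.* b)

  N-⊗ : ∀ u v → N (u ⊗ v) ≡ N u ℚ.* N v
  N-⊗ (a , b) (c , d) = solve 5 (λ a b c d e →
      (a :* c :+ e :* (b :* d)) :* (a :* c :+ e :* (b :* d)) :- e :* ((a :* d :+ b :* c) :* (a :* d :+ b :* c))
      := (a :* a :- e :* (b :* b)) :* (c :* c :- e :* (d :* d))) refl a b c d Dℚ

  N-one : N one ≡ 1ℚ
  N-one = solve 1 (λ e → con 1ℚ :* con 1ℚ :- e :* (con 0ℚ :* con 0ℚ) := con 1ℚ) refl Dℚ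

  N-pow : ∀ u k → N (pow u k) ≡ N u ^ℚ k
  N-pow u zero    = N-one
  N-pow u (suc k) = trans (N-⊗ (pow u k) u) (trans (cong (ℚ._* N u) (N-pow u k)) (ℚP.*-comm _ (N u)))

  Tr : QF → ℚ
  Tr (a , _) = fromℤ (+ 2) ℚ.* a

  Tr≡N[x+1]-N[x]-1 : ∀ x → Tr x ≡ N (x ⊕ one) ℚ.- N x ℚ.- 1ℚ
  Tr≡N[x+1]-N[x]-1 (a , b) = solve 3 (λ a b e → con (fromℤ (+ 2)) :* a
    := ((a :+ con 1ℚ) :* (a :+ con 1ℚ) :- e :* ((b :+ con 0ℚ) :* (b :+ con 0ℚ)))
       :- (a :* a :- e :* (b :* b)) :- con 1ℚ) refl a b Dℚ

module IntegralElements (D : ℕ) where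
  open QuadField D
  open ℚSolver.+-*-Solver
  open QuadFieldProperties D

  infix 4 _·_∈ℤ²
  record _·_∈ℤ² (L : ℕ) (z : QF) : Set where
    constructor _,_
    field
      proj₁∈ℤ : fromℤ (+ L) ℚ.* proj₁ z ∈ℤ
      proj₂∈ℤ : fromℤ (+ L) ℚ.* proj₂ z ∈ℤ

  ·∈ℤ²-⊕ : ∀ {L} u v → L · u ∈ℤ² → L · v ∈ℤ² → L · (u ⊕ v) ∈ℤ²
  ·∈ℤ²-⊕ {L} (a , b) (c , d) (la , lb) (lc , ld) =
    subst _∈ℤ (sym (ℚP.*-distribˡ-+ l a c)) (∈ℤ-+ la lc) ,
    subst _∈ℤ (sym (ℚP.*-distribˡ-+ l b d)) (∈ℤ-+ lb ld)
    where
    l : ℚ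
    l = fromℤ (+ L)

  ·∈ℤ²-ι⊗ : ∀ {L} c u → L · u ∈ℤ² → L · (ι c ⊗ u) ∈ℤ²
  ·∈ℤ²-ι⊗ {L} c (a , b) (la , lb) = subst (L ·_∈ℤ²) (sym (ι-⊗ c a b)) (scale la , scale lb)
    where
    scale : ∀ {p} → fromℤ (+ L) ℚ.* p ∈ℤ → fromℤ (+ L) ℚ.* (fromℤ c ℚ.* p) ∈ℤ
    scale {p} lp = subst _∈ℤ (solve 3 (λ c l p → c :* (l :* p) := l :* (c :* p)) refl (fromℤ c) (fromℤ (+ L)) p)
      (∈ℤ-* (fromℤ∈ℤ c) lp)

  ·∈ℤ²-zero : ∀ {L} → L · ι (+ 0) ∈ℤ²
  ·∈ℤ²-zero {L} = (+ 0 , L*0≡0) , (+ 0 , L*0≡0)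
    where
    L*0≡0 : fromℤ (+ L) ℚ.* fromℤ (+ 0) ≡ fromℤ (+ 0)
    L*0≡0 = trans (sym (fromℤ-* (+ L) (+ 0))) (cong fromℤ (ℤP.*-zeroʳ (+ L)))

  ·∈ℤ²-*ˡ : ∀ {L} M z → L · z ∈ℤ² → M ℕ.* L · z ∈ℤ²
  ·∈ℤ²-*ˡ M z (la , lb) = ∈ℤ-pos-*ˡ M la , ∈ℤ-pos-*ˡ M lb

  ·∈ℤ²-*ʳ : ∀ {L} M z → L · z ∈ℤ² → L ℕ.* M · z ∈ℤ²
  ·∈ℤ²-*ʳ {L} M z lz = subst (_· z ∈ℤ²) (ℕP.*-comm M L) (·∈ℤ²-*ˡ M z lz)

  denominator : QF → ℕ
  denominator (a , b) = ℚ.↧ₙ a ℕ.* ℚ.↧ₙ b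

  denominator·∈ℤ² : ∀ z → denominator z · z ∈ℤ²
  denominator·∈ℤ² (a , b) =
    subst (λ L → fromℤ (+ L) ℚ.* a ∈ℤ) (ℕP.*-comm (ℚ.↧ₙ b) (ℚ.↧ₙ a))
      (∈ℤ-pos-*ˡ (ℚ.↧ₙ b) {ℚ.↧ₙ a} (↧ₙ*p∈ℤ a)) ,
    ∈ℤ-pos-*ˡ (ℚ.↧ₙ a) {ℚ.↧ₙ b} (↧ₙ*p∈ℤ b)

  ·∈ℤ²⇒N∈ℤ : ∀ L z → L · z ∈ℤ² → fromℤ (+ (L ℕ.* L)) ℚ.* N z ∈ℤ
  ·∈ℤ²⇒N∈ℤ L (a , b) (la , lb) =
    subst _∈ℤ eq (∈ℤ-- (∈ℤ-* la la) (∈ℤ-* (fromℤ∈ℤ (+ D)) (∈ℤ-* lb lb)))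
    where
    l : ℚ
    l = fromℤ (+ L)
    eq : (l ℚ.* a) ℚ.* (l ℚ.* a) ℚ.- Dℚ ℚ.* ((l ℚ.* b) ℚ.* (l ℚ.* b)) ≡ fromℤ (+ (L ℕ.* L)) ℚ.* N (a , b)
    eq = trans (solve 4 (λ l a b e → (l :* a) :* (l :* a) :- e :* ((l :* b) :* (l :* b))
                                   := l :* l :* (a :* a :- e :* (b :* b))) refl l a b Dℚ)
               (cong (ℚ._* N (a , b)) (sym (fromℤ-pos-* L L)))

  bounded-powers⇒N∈ℤ : ∀ L .{{_ : ℕ.NonZero L}} w → (∀ k → L · pow w k ∈ℤ²) → N w ∈ℤ
  bounded-powers⇒N∈ℤ L w bounded = bounded-denominators⇒∈ℤ (L ℕ.* L) {{ℕP.m*n≢0 L L}} (N w) λ k →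
    subst (λ r → fromℤ (+ (L ℕ.* L)) ℚ.* r ∈ℤ) (N-pow w k) (·∈ℤ²⇒N∈ℤ L (pow w k) (bounded k))

  bounded-powers-shift : ∀ {L} x → (∀ k → L · pow x k ∈ℤ²) → ∀ k → L · pow (x ⊕ one) k ∈ℤ²
  bounded-powers-shift {L} x bounded k =
    subst (L ·_∈ℤ²) (⊗-identityʳ (pow (x ⊕ one) k)) (mixed k 0)
    where
    mixed : ∀ k j → L · pow (x ⊕ one) k ⊗ pow x j ∈ℤ²
    mixed zero    j = subst (L ·_∈ℤ²) (sym (⊗-identityˡ (pow x j))) (bounded j)
    mixed (suc k) j = subst (L ·_∈ℤ²) (sym expand)
      (·∈ℤ²-⊕ (y ⊗ pow x (suc j)) (y ⊗ pow x j) (mixed k (suc j)) (mixed k j))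
      where
      y p : QF
      y = pow (x ⊕ one) k
      p = pow x j
      expand : (y ⊗ (x ⊕ one)) ⊗ p ≡ (y ⊗ (p ⊗ x)) ⊕ (y ⊗ p)
      expand = begin
        (y ⊗ (x ⊕ one)) ⊗ p            ≡⟨ ⊗-assoc y (x ⊕ one) p ⟩
        y ⊗ ((x ⊕ one) ⊗ p)            ≡⟨ cong (y ⊗_) (⊗-distribʳ-⊕ x one p) ⟩
        y ⊗ ((x ⊗ p) ⊕ (one ⊗ p))      ≡⟨ cong (λ q → y ⊗ (q ⊕ (one ⊗ p))) (⊗-comm x p) ⟩
        y ⊗ ((p ⊗ x) ⊕ (one ⊗ p))      ≡⟨ cong (λ q → y ⊗ ((p ⊗ x) ⊕ q)) (⊗-identityˡ p) ⟩
        y ⊗ ((p ⊗ x) ⊕ p)              ≡⟨ ⊗-distribˡ-⊕ y (p ⊗ x) p ⟩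
        (y ⊗ (p ⊗ x)) ⊕ (y ⊗ p)        ∎
        where open ≡-Reasoning

  module _ (x : QF) where

    lowerTerms : List ℤ → QF
    lowerTerms []        = ι (+ 0)
    lowerTerms (c ∷ cs) = (ι c ⊗ pow x (length cs)) ⊕ lowerTerms cs

    horner : ∀ acc cs →
             foldl (λ acc c → (acc ⊗ x) ⊕ ι c) acc cs ≡ (acc ⊗ pow x (length cs)) ⊕ lowerTerms cs
    horner acc []       = sym (trans (cong (_⊕ ι (+ 0)) (⊗-identityʳ acc)) (⊕-identityʳ acc))
    horner acc (c ∷ cs) = trans (horner ((acc ⊗ x) ⊕ ι c) cs)
      (trans (cong (_⊕ lowerTerms cs) (trans (⊗-distribʳ-⊕ (acc ⊗ x) (ι c) p) (cong (_⊕ (ι c ⊗ p)) shift)))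
             (⊕-assoc (acc ⊗ (p ⊗ x)) (ι c ⊗ p) (lowerTerms cs)))
      where
      p : QF
      p = pow x (length cs)
      shift : (acc ⊗ x) ⊗ p ≡ acc ⊗ (p ⊗ x)
      shift = trans (⊗-assoc acc x p) (cong (acc ⊗_) (⊗-comm x p))

    ·∈ℤ²-⊗lowerTerms : ∀ {L} w cs → (∀ i → i < length cs → L · w ⊗ pow x i ∈ℤ²) →
                       L · w ⊗ lowerTerms cs ∈ℤ²
    ·∈ℤ²-⊗lowerTerms {L} w []       _       = subst (L ·_∈ℤ²) (sym (⊗-zeroʳ w)) ·∈ℤ²-zero
    ·∈ℤ²-⊗lowerTerms {L} w (c ∷ cs) bounded = subst (L ·_∈ℤ²) (sym expand)
      (·∈ℤ²-⊕ _ _ (·∈ℤ²-ι⊗ c _ (bounded (length cs) (ℕP.n<1+n _)))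
                  (·∈ℤ²-⊗lowerTerms w cs (λ i i<n → bounded i (ℕP.m<n⇒m<1+n i<n))))
      where
      p : QF
      p = pow x (length cs)
      expand : w ⊗ ((ι c ⊗ p) ⊕ lowerTerms cs) ≡ (ι c ⊗ (w ⊗ p)) ⊕ (w ⊗ lowerTerms cs)
      expand = trans (⊗-distribˡ-⊕ w (ι c ⊗ p) (lowerTerms cs))
                     (cong (_⊕ (w ⊗ lowerTerms cs)) (⊗-left-comm w (ι c) p))

    commonDenominator : ℕ → ℕ
    commonDenominator zero    = 1
    commonDenominator (suc k) = commonDenominator k ℕ.* denominator (pow x k)

    commonDenominator-nonZero : ∀ k → ℕ.NonZero (commonDenominator k)
    commonDenominator-nonZero zero    = _
    commonDenominator-nonZero (suc k) = ℕP.m*n≢0 (commonDenominator k) (denominator (pow x k))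
      {{commonDenominator-nonZero k}} {{ℕP.m*n≢0 (ℚ.↧ₙ (proj₁ (pow x k))) (ℚ.↧ₙ (proj₂ (pow x k)))}}

    commonDenominator·pow∈ℤ² : ∀ k i → i < k → commonDenominator k · pow x i ∈ℤ²
    commonDenominator·pow∈ℤ² (suc k) i i<1+k with i ℕP.<? k
    ... | yes i<k = ·∈ℤ²-*ʳ (denominator (pow x k)) (pow x i) (commonDenominator·pow∈ℤ² k i i<k)
    ... | no  i≮k rewrite ℕP.≤-antisym (ℕ.s≤s⁻¹ i<1+k) (ℕP.≮⇒≥ i≮k) =
      ·∈ℤ²-*ˡ (commonDenominator k) (pow x k) (denominator·∈ℤ² (pow x k))

  integral⇒bounded-powers : ∀ x → IsIntegral x → Σ ℕ λ L → ℕ.NonZero L × (∀ k → L · pow x k ∈ℤ²)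
  integral⇒bounded-powers x (cs , root) = L , commonDenominator-nonZero x n , λ k →
    subst (λ j → L · pow x j ∈ℤ²) (ℕP.+-identityʳ k) (window k 0 (degree>0 cs root))
    where
    n L : ℕ
    n = length cs
    L = commonDenominator x n

    degree>0 : ∀ cs → evalMonic cs x ≡ ι (+ 0) → 0 < length cs
    degree>0 []      one≡0 = contradiction (cong proj₁ one≡0) ℚP.1≢0
    degree>0 (_ ∷ _) _     = ℕ.z<s

    reduce : ∀ w → w ⊗ pow x n ≡ ι (- + 1) ⊗ (w ⊗ lowerTerms x cs)
    reduce w = trans (cong (w ⊗_) (⊕≡0⇒≡-1⊗ (pow x n) (lowerTerms x cs) xⁿ+lower≡0))
                     (⊗-left-comm w (ι (- + 1)) (lowerTerms x cs))
      where
      xⁿ+lower≡0 : pow x n ⊕ lowerTerms x cs ≡ ι (+ 0)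
      xⁿ+lower≡0 = trans (cong (_⊕ lowerTerms x cs) (sym (⊗-identityˡ (pow x n))))
                         (trans (sym (horner x one cs)) root)

    -- Each window xᵐ, …, xᵐ⁺ⁿ⁻¹ of n consecutive powers is cleared by L: the next power is
    -- an integer combination of the window.
    window : ∀ m i → i < n → L · pow x (m ℕ.+ i) ∈ℤ²
    window zero    = commonDenominator·pow∈ℤ² x n
    window (suc m) i i<n with suc i ℕP.<? n
    ... | yes 1+i<n = subst (λ j → L · pow x j ∈ℤ²) (ℕP.+-suc m i) (window m (suc i) 1+i<n)
    ... | no  1+i≮n = subst (L ·_∈ℤ²) (sym xᵐ⁺ⁿ≡) (·∈ℤ²-ι⊗ (- + 1) _
            (·∈ℤ²-⊗lowerTerms x (pow x m) cs λ j j<n → subst (L ·_∈ℤ²) (pow-+ x m j) (window m j j<n)))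
      where
      xᵐ⁺ⁿ≡ : pow x (suc (m ℕ.+ i)) ≡ ι (- + 1) ⊗ (pow x m ⊗ lowerTerms x cs)
      xᵐ⁺ⁿ≡ = trans (cong (pow x) (sym (ℕP.+-suc m i)))
        (trans (cong (λ k → pow x (m ℕ.+ k)) (ℕP.≤-antisym i<n (ℕP.≮⇒≥ 1+i≮n)))
        (trans (pow-+ x m n) (reduce (pow x m))))

  integral⇒N∈ℤ×Tr∈ℤ : ∀ x → IsIntegral x → N x ∈ℤ × Tr x ∈ℤ
  integral⇒N∈ℤ×Tr∈ℤ x x-integral with integral⇒bounded-powers x x-integral
  ... | L , L≢0 , bounded =
    Nx∈ℤ , subst _∈ℤ (sym (Tr≡N[x+1]-N[x]-1 x)) (∈ℤ-- (∈ℤ-- N[x+1]∈ℤ Nx∈ℤ) (fromℤ∈ℤ (+ 1)))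
    where
    Nx∈ℤ : N x ∈ℤ
    Nx∈ℤ = bounded-powers⇒N∈ℤ L {{L≢0}} x bounded
    N[x+1]∈ℤ : N (x ⊕ one) ∈ℤ
    N[x+1]∈ℤ = bounded-powers⇒N∈ℤ L {{L≢0}} (x ⊕ one) (bounded-powers-shift x bounded)

module Units (D : ℕ) where
  open QuadField D
  open ℚSolver.+-*-Solver
  open QuadFieldProperties D
  open IntegralElements D

  unit⇒N≡±1 : ∀ ε → IsUnit ε → Σ ℤ λ e → N ε ≡ fromℤ e × (e ≡ 1ℤ ⊎ e ≡ -1ℤ)
  unit⇒N≡±1 ε (ε-integral , η , η-integral , εη≡1) =
    norms (integral⇒N∈ℤ×Tr∈ℤ ε ε-integral .proj₁) (integral⇒N∈ℤ×Tr∈ℤ η η-integral .proj₁)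
    where
    norms : N ε ∈ℤ → N η ∈ℤ → Σ ℤ λ e → N ε ≡ fromℤ e × (e ≡ 1ℤ ⊎ e ≡ -1ℤ)
    norms (e , Nε≡e) (f , Nη≡f) = e , Nε≡e , i*j≡1⇒i≡±1 e f (fromℤ-injective (begin
      fromℤ (e ℤ.* f)       ≡⟨ fromℤ-* e f ⟩
      fromℤ e ℚ.* fromℤ f   ≡⟨ cong₂ ℚ._*_ Nε≡e Nη≡f ⟨
      N ε ℚ.* N η           ≡⟨ N-⊗ ε η ⟨
      N (ε ⊗ η)             ≡⟨ cong N εη≡1 ⟩
      N one                 ≡⟨ N-one ⟩
      1ℚ                    ∎))
      where open ≡-Reasoning

  fromℤ-N : ∀ u v → fromℤ (u ℤ.* u ℤ.- + D ℤ.* (v ℤ.* v)) ≡ N (fromℤ u , fromℤ v)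
  fromℤ-N u v = trans (fromℤ-- (u ℤ.* u) _)
    (cong₂ ℚ._-_ (fromℤ-* u u) (trans (fromℤ-* (+ D) _) (cong (Dℚ ℚ.*_) (fromℤ-* v v))))

  halves : ℤ → ℤ → QF
  halves u v = (fromℤ u ℚ.* ½ , fromℤ v ℚ.* ½)

  -- (u + v √D) / 2 is a root of X² − u X + s.
  pell⇒integral : ∀ u v s → u ℤ.* u ℤ.- + D ℤ.* (v ℤ.* v) ≡ + 4 ℤ.* s → IsIntegral (halves u v)
  pell⇒integral u v s pell = (- u ∷ s ∷ []) ,
    trans (cong (λ t → (((one ⊗ x) ⊕ (t , 0ℚ)) ⊗ x) ⊕ ι s) (fromℤ-neg u)) (cong₂ _,_ root₁ root₂)
    where
    x : QF
    x = halves u v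
    U V S : ℚ
    U = fromℤ u
    V = fromℤ v
    S = fromℤ s
    value : QF
    value = (((one ⊗ x) ⊕ (ℚ.- U , 0ℚ)) ⊗ x) ⊕ ι s
    pellℚ : U ℚ.* U ℚ.- Dℚ ℚ.* (V ℚ.* V) ℚ.- fromℤ (+ 4) ℚ.* S ≡ 0ℚ
    pellℚ = trans (cong (ℚ._- fromℤ (+ 4) ℚ.* S)
                        (trans (sym (fromℤ-N u v)) (trans (cong fromℤ pell) (fromℤ-* (+ 4) s))))
                  (ℚP.+-inverseʳ (fromℤ (+ 4) ℚ.* S))
    root₁ : proj₁ value ≡ 0ℚ
    root₁ = trans (solve 4 (λ U V S E →
        ((con 1ℚ :* (U :* con ½) :+ E :* (con 0ℚ :* (V :* con ½)) :+ (:- U)) :* (U :* con ½)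
          :+ E :* ((con 1ℚ :* (V :* con ½) :+ con 0ℚ :* (U :* con ½) :+ con 0ℚ) :* (V :* con ½))) :+ S
        := con (ℚ.- (+ 1 / 4)) :* (U :* U :- E :* (V :* V) :- con (fromℤ (+ 4)) :* S)) refl U V S Dℚ)
      (trans (cong (ℚ.- (+ 1 / 4) ℚ.*_) pellℚ) (ℚP.*-zeroʳ (ℚ.- (+ 1 / 4))))
    root₂ : proj₂ value ≡ 0ℚ
    root₂ = solve 3 (λ U V E →
        (con 1ℚ :* (U :* con ½) :+ E :* (con 0ℚ :* (V :* con ½)) :+ (:- U)) :* (V :* con ½)
          :+ (con 1ℚ :* (V :* con ½) :+ con 0ℚ :* (U :* con ½) :+ con 0ℚ) :* (U :* con ½) :+ con 0ℚ
        := con 0ℚ) refl U V Dℚ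

  pell⇒unit : ∀ u v s → s ℤ.* s ≡ 1ℤ → u ℤ.* u ℤ.- + D ℤ.* (v ℤ.* v) ≡ + 4 ℤ.* s → IsUnit (halves u v)
  pell⇒unit u v s s²≡1 pell =
    pell⇒integral u v s pell , halves (s ℤ.* u) (- (s ℤ.* v)) , pell⇒integral (s ℤ.* u) (- (s ℤ.* v)) s pell′ ,
    trans (cong (halves u v ⊗_) η≡) (cong₂ _,_ product₁ product₂)
    where
    open ≡-Reasoning
    U V S : ℚ
    U = fromℤ u
    V = fromℤ v
    S = fromℤ s
    pell′ : (s ℤ.* u) ℤ.* (s ℤ.* u) ℤ.- + D ℤ.* (- (s ℤ.* v) ℤ.* - (s ℤ.* v)) ≡ + 4 ℤ.* s
    pell′ = trans (scaled-conjugate-norm (+ D) s u v)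
      (trans (cong₂ ℤ._*_ s²≡1 pell) (ℤP.*-identityˡ (+ 4 ℤ.* s)))
    S²≡1 : S ℚ.* S ≡ 1ℚ
    S²≡1 = trans (sym (fromℤ-* s s)) (cong fromℤ s²≡1)
    pellℚ : U ℚ.* U ℚ.- Dℚ ℚ.* (V ℚ.* V) ≡ fromℤ (+ 4) ℚ.* S
    pellℚ = trans (sym (fromℤ-N u v)) (trans (cong fromℤ pell) (fromℤ-* (+ 4) s))
    η≡ : halves (s ℤ.* u) (- (s ℤ.* v)) ≡ (S ℚ.* U ℚ.* ½ , ℚ.- (S ℚ.* V) ℚ.* ½)
    η≡ = cong₂ _,_ (cong (ℚ._* ½) (fromℤ-* s u))
                   (cong (ℚ._* ½) (trans (fromℤ-neg (s ℤ.* v)) (cong ℚ.-_ (fromℤ-* s v))))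
    product₁ : U ℚ.* ½ ℚ.* (S ℚ.* U ℚ.* ½) ℚ.+ Dℚ ℚ.* (V ℚ.* ½ ℚ.* (ℚ.- (S ℚ.* V) ℚ.* ½)) ≡ 1ℚ
    product₁ = begin
      U ℚ.* ½ ℚ.* (S ℚ.* U ℚ.* ½) ℚ.+ Dℚ ℚ.* (V ℚ.* ½ ℚ.* (ℚ.- (S ℚ.* V) ℚ.* ½))
        ≡⟨ solve 4 (λ S U V E → U :* con ½ :* (S :* U :* con ½) :+ E :* (V :* con ½ :* ((:- (S :* V)) :* con ½))
                 := con (+ 1 / 4) :* S :* (U :* U :- E :* (V :* V))) refl S U V Dℚ ⟩
      (+ 1 / 4) ℚ.* S ℚ.* (U ℚ.* U ℚ.- Dℚ ℚ.* (V ℚ.* V))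
        ≡⟨ cong ((+ 1 / 4) ℚ.* S ℚ.*_) pellℚ ⟩
      (+ 1 / 4) ℚ.* S ℚ.* (fromℤ (+ 4) ℚ.* S)
        ≡⟨ solve 1 (λ S → con (+ 1 / 4) :* S :* (con (fromℤ (+ 4)) :* S) := S :* S) refl S ⟩
      S ℚ.* S
        ≡⟨ S²≡1 ⟩
      1ℚ ∎
    product₂ : U ℚ.* ½ ℚ.* (ℚ.- (S ℚ.* V) ℚ.* ½) ℚ.+ V ℚ.* ½ ℚ.* (S ℚ.* U ℚ.* ½) ≡ 0ℚ
    product₂ = solve 3 (λ S U V → U :* con ½ :* ((:- (S :* V)) :* con ½) :+ V :* con ½ :* (S :* U :* con ½)
                              := con 0ℚ) refl S U V

  record UnitCoordinates (a b : ℚ) : Set where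
    field
      A Y e : ℤ
      2a≡A  : Tr (a , b) ≡ fromℤ A
      2b≡Y  : fromℤ (+ 2) ℚ.* b ≡ fromℤ Y
      e≡±1  : e ≡ 1ℤ ⊎ e ≡ -1ℤ
      pell  : A ℤ.* A ℤ.- + D ℤ.* (Y ℤ.* Y) ≡ + 4 ℤ.* e

  unit⇒UnitCoordinates : SquareFree D → ∀ a b → IsUnit (a , b) → UnitCoordinates a b
  unit⇒UnitCoordinates squarefree a b ε-unit =
    build (unit⇒N≡±1 (a , b) ε-unit) (integral⇒N∈ℤ×Tr∈ℤ (a , b) (ε-unit .proj₁) .proj₂)
    where
    2b : ℚ
    2b = fromℤ (+ 2) ℚ.* b
    N[2a,2b]≡4N : N (Tr (a , b) , 2b) ≡ fromℤ (+ 4) ℚ.* N (a , b)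
    N[2a,2b]≡4N = solve 3 (λ a b e → (con (fromℤ (+ 2)) :* a) :* (con (fromℤ (+ 2)) :* a)
                                     :- e :* ((con (fromℤ (+ 2)) :* b) :* (con (fromℤ (+ 2)) :* b))
                                   := con (fromℤ (+ 4)) :* (a :* a :- e :* (b :* b))) refl a b Dℚ
    build : (Σ ℤ λ e → N (a , b) ≡ fromℤ e × (e ≡ 1ℤ ⊎ e ≡ -1ℤ)) → Tr (a , b) ∈ℤ → UnitCoordinates a b
    build (e , N≡e , e≡±1) (A , 2a≡A) = record
      { A = A ; Y = proj₁ 2b∈ℤ ; e = e ; 2a≡A = 2a≡A ; 2b≡Y = proj₂ 2b∈ℤ ; e≡±1 = e≡±1
      ; pell = fromℤ-injective (trans (fromℤ-N A (proj₁ 2b∈ℤ))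
                 (trans (cong (λ y → N (fromℤ A , y)) (sym (proj₂ 2b∈ℤ))) N[A,2b]≡4e)) }
      where
      N[A,2b]≡4e : N (fromℤ A , 2b) ≡ fromℤ (+ 4 ℤ.* e)
      N[A,2b]≡4e = trans (cong (λ x → N (x , 2b)) (sym 2a≡A))
        (trans N[2a,2b]≡4N (trans (cong (fromℤ (+ 4) ℚ.*_) N≡e) (sym (fromℤ-* (+ 4) e))))
      D[2b]²∈ℤ : Dℚ ℚ.* (2b ℚ.* 2b) ≡ fromℤ (A ℤ.* A ℤ.- + 4 ℤ.* e)
      D[2b]²∈ℤ = begin
        Dℚ ℚ.* (2b ℚ.* 2b)
          ≡⟨ solve 3 (λ x y e → e :* (y :* y) := x :* x :- (x :* x :- e :* (y :* y))) refl (fromℤ A) 2b Dℚ ⟩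
        fromℤ A ℚ.* fromℤ A ℚ.- N (fromℤ A , 2b)
          ≡⟨ cong₂ ℚ._-_ (sym (fromℤ-* A A)) N[A,2b]≡4e ⟩
        fromℤ (A ℤ.* A) ℚ.- fromℤ (+ 4 ℤ.* e)
          ≡⟨ fromℤ-- (A ℤ.* A) (+ 4 ℤ.* e) ⟨
        fromℤ (A ℤ.* A ℤ.- + 4 ℤ.* e) ∎
        where open ≡-Reasoning
      2b∈ℤ : 2b ∈ℤ
      2b∈ℤ = squarefree⇒∈ℤ squarefree 2b (A ℤ.* A ℤ.- + 4 ℤ.* e) D[2b]²∈ℤ

module SumsOfUnits (D : ℕ) (squarefree : SquareFree D) where
  open QuadField D
  open QuadFieldProperties D
  open Units D
  open ℚSolver.+-*-Solver

  sum-of-units⇒Pell±4 : ∀ n → InN n → ∃[ y ] Pell±4 D n y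
  sum-of-units⇒Pell±4 n (n≥1 , (a , b) , (c , d) , ε-unit , δ-unit , ε+δ≡n) =
    combine (unit⇒UnitCoordinates squarefree a b ε-unit) (unit⇒UnitCoordinates squarefree c d δ-unit)
    where
    combine : UnitCoordinates a b → UnitCoordinates c d → ∃[ y ] Pell±4 D n y
    combine ε δ = traces⇒Pell±4 D n ε.A ε.Y n≥1 ε.e≡±1 δ.e≡±1
      ([A-n]n≡e₁-e₂ D n ε.A δ.A ε.Y ε.e δ.e ε.pell pell₂ A+C≡2n) ε.pell
      where
      module ε = UnitCoordinates ε
      module δ = UnitCoordinates δ
      open ≡-Reasoning
      d≡-b : d ≡ ℚ.- b
      d≡-b = trans (solve 2 (λ b d → d := (b :+ d) :- b) refl b d)
                   (trans (cong (ℚ._- b) (cong proj₂ ε+δ≡n)) (ℚP.+-identityˡ (ℚ.- b)))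
      Yδ≡-Yε : δ.Y ≡ - ε.Y
      Yδ≡-Yε = fromℤ-injective (begin
        fromℤ δ.Y                   ≡⟨ δ.2b≡Y ⟨
        fromℤ (+ 2) ℚ.* d           ≡⟨ cong (fromℤ (+ 2) ℚ.*_) d≡-b ⟩
        fromℤ (+ 2) ℚ.* ℚ.- b       ≡⟨ ℚP.neg-distribʳ-* (fromℤ (+ 2)) b ⟨
        ℚ.- (fromℤ (+ 2) ℚ.* b)     ≡⟨ cong ℚ.-_ ε.2b≡Y ⟩
        ℚ.- fromℤ ε.Y               ≡⟨ fromℤ-neg ε.Y ⟨
        fromℤ (- ε.Y)               ∎)
      pell₂ : δ.A ℤ.* δ.A ℤ.- + D ℤ.* (ε.Y ℤ.* ε.Y) ≡ + 4 ℤ.* δ.e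
      pell₂ = subst (λ y → δ.A ℤ.* δ.A ℤ.- + D ℤ.* y ≡ + 4 ℤ.* δ.e)
                (trans (cong (λ y → y ℤ.* y) Yδ≡-Yε) (-i*-i≡i*i ε.Y)) δ.pell
      A+C≡2n : ε.A ℤ.+ δ.A ≡ + 2 ℤ.* + n
      A+C≡2n = fromℤ-injective (begin
        fromℤ (ε.A ℤ.+ δ.A)                       ≡⟨ fromℤ-+ ε.A δ.A ⟩
        fromℤ ε.A ℚ.+ fromℤ δ.A                   ≡⟨ cong₂ ℚ._+_ ε.2a≡A δ.2a≡A ⟨
        fromℤ (+ 2) ℚ.* a ℚ.+ fromℤ (+ 2) ℚ.* c   ≡⟨ ℚP.*-distribˡ-+ (fromℤ (+ 2)) a c ⟨
        fromℤ (+ 2) ℚ.* (a ℚ.+ c)                 ≡⟨ cong (fromℤ (+ 2) ℚ.*_) (cong proj₁ ε+δ≡n) ⟩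
        fromℤ (+ 2) ℚ.* fromℤ (+ n)               ≡⟨ fromℤ-* (+ 2) (+ n) ⟨
        fromℤ (+ 2 ℤ.* + n)                       ∎)

  pell⇒sum-of-units : ∀ n y s → 1 ≤ n → s ℤ.* s ≡ 1ℤ →
    + n ℤ.* + n ℤ.- + D ℤ.* (y ℤ.* y) ≡ + 4 ℤ.* s → InN n
  pell⇒sum-of-units n y s n≥1 s²≡1 pell =
    n≥1 , halves (+ n) y , halves (+ n) (- y) ,
    pell⇒unit (+ n) y s s²≡1 pell , pell⇒unit (+ n) (- y) s s²≡1 pell′ , cong₂ _,_ sum₁ sum₂
    where
    pell′ : + n ℤ.* + n ℤ.- + D ℤ.* (- y ℤ.* - y) ≡ + 4 ℤ.* s
    pell′ = subst (λ t → + n ℤ.* + n ℤ.- + D ℤ.* t ≡ + 4 ℤ.* s) (sym (-i*-i≡i*i y)) pell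
    sum₁ : fromℤ (+ n) ℚ.* ½ ℚ.+ fromℤ (+ n) ℚ.* ½ ≡ fromℤ (+ n)
    sum₁ = solve 1 (λ n → n :* con ½ :+ n :* con ½ := n) refl (fromℤ (+ n))
    sum₂ : fromℤ y ℚ.* ½ ℚ.+ fromℤ (- y) ℚ.* ½ ≡ 0ℚ
    sum₂ = trans (cong (λ t → fromℤ y ℚ.* ½ ℚ.+ t ℚ.* ½) (fromℤ-neg y))
                 (solve 1 (λ y → y :* con ½ :+ (:- y) :* con ½ := con 0ℚ) refl (fromℤ y))

  Pell±4⇒sum-of-units : ∀ n → 1 ≤ n → ∃[ y ] Pell±4 D n y → InN n
  Pell±4⇒sum-of-units n n≥1 (y , inj₁ pell) = pell⇒sum-of-units n y 1ℤ  n≥1 refl pell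
  Pell±4⇒sum-of-units n n≥1 (y , inj₂ pell) = pell⇒sum-of-units n y -1ℤ n≥1 refl pell

  D·y²≡m⇒IsQSqrt : ∀ y m → + D ℤ.* (y ℤ.* y) ≡ m → y ≢ + 0 → IsQSqrt m
  D·y²≡m⇒IsQSqrt y m Dy²≡m y≢0 = (0ℚ , fromℤ y) , cong₂ _,_ square₁ square₂ , y≢0 ∘ fromℤ-injective
    where
    square₁ : 0ℚ ℚ.* 0ℚ ℚ.+ Dℚ ℚ.* (fromℤ y ℚ.* fromℤ y) ≡ fromℤ m
    square₁ = trans (solve 2 (λ e y → con 0ℚ :* con 0ℚ :+ e :* (y :* y) := e :* (y :* y)) refl Dℚ (fromℤ y))
      (trans (cong (Dℚ ℚ.*_) (sym (fromℤ-* y y))) (trans (sym (fromℤ-* (+ D) (y ℤ.* y))) (cong fromℤ Dy²≡m)))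
    square₂ : 0ℚ ℚ.* fromℤ y ℚ.+ fromℤ y ℚ.* 0ℚ ≡ 0ℚ
    square₂ = solve 1 (λ y → con 0ℚ :* y :+ y :* con 0ℚ := con 0ℚ) refl (fromℤ y)

  -- (a + b √D)² ∈ ℚ with b ≠ 0 forces a = 0, and then D b² = m.
  IsQSqrt⇒D·y²≡m : ∀ m → IsQSqrt m → Σ ℤ λ y → + D ℤ.* (y ℤ.* y) ≡ m
  IsQSqrt⇒D·y²≡m m ((a , b) , x²≡m , b≢0) = y , fromℤ-injective (begin
    fromℤ (+ D ℤ.* (y ℤ.* y))       ≡⟨ fromℤ-* (+ D) (y ℤ.* y) ⟩
    Dℚ ℚ.* fromℤ (y ℤ.* y)          ≡⟨ cong (Dℚ ℚ.*_) (fromℤ-* y y) ⟩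
    Dℚ ℚ.* (fromℤ y ℚ.* fromℤ y)    ≡⟨ cong (λ t → Dℚ ℚ.* (t ℚ.* t)) b≡y ⟨
    Dℚ ℚ.* (b ℚ.* b)                ≡⟨ Db²≡m ⟩
    fromℤ m                         ∎)
    where
    open ≡-Reasoning
    instance
      b-nonZero : ℚ.NonZero b
      b-nonZero = ℚ.≢-nonZero b≢0
    ab≡0 : a ℚ.* b ≡ 0ℚ
    ab≡0 = trans (solve 2 (λ a b → a :* b := con ½ :* (a :* b :+ b :* a)) refl a b)
                 (trans (cong (½ ℚ.*_) (cong proj₂ x²≡m)) (ℚP.*-zeroʳ ½))
    a≡0 : a ≡ 0ℚ
    a≡0 = begin
      a                       ≡⟨ ℚP.*-identityʳ a ⟨
      a ℚ.* 1ℚ                ≡⟨ cong (a ℚ.*_) (ℚP.*-inverseʳ b) ⟨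
      a ℚ.* (b ℚ.* ℚ.1/ b)    ≡⟨ ℚP.*-assoc a b (ℚ.1/ b) ⟨
      a ℚ.* b ℚ.* ℚ.1/ b      ≡⟨ cong (ℚ._* ℚ.1/ b) ab≡0 ⟩
      0ℚ ℚ.* ℚ.1/ b           ≡⟨ ℚP.*-zeroˡ (ℚ.1/ b) ⟩
      0ℚ                      ∎
    Db²≡m : Dℚ ℚ.* (b ℚ.* b) ≡ fromℤ m
    Db²≡m = trans (solve 2 (λ e b → e :* (b :* b) := con 0ℚ :* con 0ℚ :+ e :* (b :* b)) refl Dℚ b)
                  (subst (λ t → t ℚ.* t ℚ.+ Dℚ ℚ.* (b ℚ.* b) ≡ fromℤ m) a≡0 (cong proj₁ x²≡m))
    b∈ℤ : b ∈ℤ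
    b∈ℤ = squarefree⇒∈ℤ squarefree b m Db²≡m
    y : ℤ
    y = proj₁ b∈ℤ
    b≡y : b ≡ fromℤ y
    b≡y = proj₂ b∈ℤ

  Pell±4⇒IsQSqrt : ∀ n → n ≢ 2 → ∃[ y ] Pell±4 D n y →
    IsQSqrt (+ n ℤ.* + n ℤ.+ + 4) ⊎ IsQSqrt (+ n ℤ.* + n ℤ.- + 4)
  Pell±4⇒IsQSqrt n n≢2 (y , pell) = from pell
    where
    y≢0 : y ≢ + 0
    y≢0 refl = n≢2 (Pell±4-at-0⇒n≡2 D n pell)
    n² Dy² : ℤ
    n² = + n ℤ.* + n
    Dy² = + D ℤ.* (y ℤ.* y)
    from : Pell±4 D n y → IsQSqrt (+ n ℤ.* + n ℤ.+ + 4) ⊎ IsQSqrt (+ n ℤ.* + n ℤ.- + 4)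
    from (inj₁ pell) = inj₂ (D·y²≡m⇒IsQSqrt y (n² ℤ.- + 4) (i-j≡k⇒j≡i-k n² Dy² (+ 4) pell) y≢0)
    from (inj₂ pell) = inj₁ (D·y²≡m⇒IsQSqrt y (n² ℤ.+ + 4) (i-j≡k⇒j≡i-k n² Dy² (- + 4) pell) y≢0)

  IsQSqrt⇒Pell±4 : ∀ n → IsQSqrt (+ n ℤ.* + n ℤ.+ + 4) ⊎ IsQSqrt (+ n ℤ.* + n ℤ.- + 4) →
                   ∃[ y ] Pell±4 D n y
  IsQSqrt⇒Pell±4 n (inj₁ root) = D·y²≡n²+4⇒Pell±4 D n (IsQSqrt⇒D·y²≡m (+ n ℤ.* + n ℤ.+ + 4) root)
  IsQSqrt⇒Pell±4 n (inj₂ root) = D·y²≡n²-4⇒Pell±4 D n (IsQSqrt⇒D·y²≡m (+ n ℤ.* + n ℤ.- + 4) root)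

proposition2p2 : (D : ℕ) → 2 ℕ.≤ D → SquareFree D →
    ((n : ℕ) → QuadField.InN D n ⇔ ((1 ℕ.≤ n) × ∃[ y ] ((+ n) ℤ.* (+ n) ℤ.- (+ D) ℤ.* (y ℤ.* y) ≡ + 4 ⊎ (+ n) ℤ.* (+ n) ℤ.- (+ D) ℤ.* (y ℤ.* y) ≡ - (+ 4))))
    × ((n : ℕ) → 1 ℕ.≤ n → n ≢ 2 → QuadField.InN D n ⇔ (QuadField.IsQSqrt D ((+ n) ℤ.* (+ n) ℤ.+ + 4) ⊎ QuadField.IsQSqrt D ((+ n) ℤ.* (+ n) ℤ.- + 4)))
proposition2p2 D _ squarefree =
  (λ n → mk⇔ (λ n∈𝒩 → proj₁ n∈𝒩 , sum-of-units⇒Pell±4 n n∈𝒩)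
             (λ (n≥1 , pell) → Pell±4⇒sum-of-units n n≥1 pell)) ,
  (λ n n≥1 n≢2 → mk⇔ (λ n∈𝒩 → Pell±4⇒IsQSqrt n n≢2 (sum-of-units⇒Pell±4 n n∈𝒩))
                     (λ root → Pell±4⇒sum-of-units n n≥1 (IsQSqrt⇒Pell±4 n root)))
  where open SumsOfUnits D squarefree
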